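{- If $G$ is a cycle with an odd number $n\ge 3$ of vertices, then its Mycielskian $\mu(G)$ is Hamilton-connected.
   Context: For a graph $G$ with vertex set $X=\{x_1,\dots,x_n\}$, the Mycielskian $\mu(G)$ has vertex set $X\cup Y\cup\{z\}$ with $Y=\{y_1,\dots,y_n\}$ new vertices and $z$ a new vertex; its edges are the edges of $G$, the edges $zy_i$ for all $i$, and the edges $x_iy_j$ and $x_jy_i$ for every edge $x_ix_j$ of $G$. A graph is Hamilton-connected if for every pair of distinct vertices $u,v$ there is a Hamiltonian path from $u$ to $v$. -}

module Defs where

open import Data.Nat using (ℕ; suc; _+_)
open import Data.Fin using (Fin; toℕ)
open import Data.Sum using (_⊎_; inj₁; inj₂)
open import Data.Unit using (⊤; tt)
open import Data.Empty using (⊥)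
open import Data.Product using (_×_; ∃; ∃-syntax)
open import Data.List using (List; []; _∷_; head; last)
open import Data.Maybe using (just)
open import Data.List.Membership.Propositional using (_∈_)
open import Data.List.Relation.Unary.Unique.Propositional using (Unique)
open import Relation.Binary.PropositionalEquality using (_≡_)
open import Relation.Nullary using (¬_)

record Graph : Set₁ where
  field
    V   : Set
    Adj : V → V → Set
open Graph public

-- The cycle C_n on vertex set Fin n (vertices 0,…,n-1, i ~ i+1 mod n).
-- Intended for n ≥ 3, where it is a simple graph.
cycleAdj : (n : ℕ) → Fin n → Fin n → Set
cycleAdj n i j = Succ i j ⊎ Succ j i
  where
  Succ : Fin n → Fin n → Set
  Succ a b = (toℕ b ≡ suc (toℕ a)) ⊎ ((suc (toℕ a) ≡ n) × (toℕ b ≡ 0))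

Cycle : ℕ → Graph
Cycle n = record { V = Fin n ; Adj = cycleAdj n }

-- Mycielskian: vertex set X ⊎ (Y ⊎ {z}), where X = V G (x_i = inj₁ i),
-- Y a copy of V G (y_i = inj₂ (inj₁ i)) and z = inj₂ (inj₂ tt).
MyVert : Set → Set
MyVert V = V ⊎ (V ⊎ ⊤)

myAdj : (G : Graph) → MyVert (V G) → MyVert (V G) → Set
myAdj G (inj₁ i)        (inj₁ j)        = Adj G i j
myAdj G (inj₁ i)        (inj₂ (inj₁ j)) = Adj G i j
myAdj G (inj₂ (inj₁ i)) (inj₁ j)        = Adj G i j
myAdj G (inj₂ (inj₁ i)) (inj₂ (inj₁ j)) = ⊥
myAdj G (inj₂ (inj₁ i)) (inj₂ (inj₂ _)) = ⊤
myAdj G (inj₂ (inj₂ _)) (inj₂ (inj₁ j)) = ⊤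
myAdj G (inj₂ (inj₂ _)) (inj₂ (inj₂ _)) = ⊥
myAdj G (inj₁ i)        (inj₂ (inj₂ _)) = ⊥
myAdj G (inj₂ (inj₂ _)) (inj₁ j)        = ⊥

Mycielskian : Graph → Graph
Mycielskian G = record { V = MyVert (V G) ; Adj = myAdj G }

data Walk (G : Graph) : List (V G) → Set where
  []  : Walk G []
  [_] : ∀ v → Walk G (v ∷ [])
  _∷_ : ∀ {u v vs} → Adj G u v → Walk G (v ∷ vs) → Walk G (u ∷ v ∷ vs)

record HamPath (G : Graph) (u v : V G) : Set where
  field
    path    : List (V G)
    walk    : Walk G path
    unique  : Unique path
    covers  : ∀ w → w ∈ path
    starts  : head path ≡ just u
    ends    : last path ≡ just v

HamiltonConnected : Graph → Set
HamiltonConnected G = ∀ (u v : V G) → ¬ (u ≡ v) → HamPath G u v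

module Submission where

-- Let spine j be x_(j mod n) for even j and y_(j mod n) for odd j.  As n is odd, spine has period 2n
-- and meets every vertex other than z exactly once per period: it is a Hamiltonian cycle of μ(C_n) − z.
-- Besides its edges there are the chords spine j ~ spine (j + n + 1) for even j (the edges x_i x_(i+1)),
-- and z is adjacent to every odd position.  Two vertices other than z sit at two positions of this
-- cycle; according to the parities of the positions and to whether their distance is smaller than,
-- equal to or larger than n, an explicit route made of arcs of the cycle, at most two chords and one
-- detour through z joins them.  Such a route has 2n + 1 vertices and passes through all of them, so
-- it repeats none.

open import Defs
open import Data.Nat using (ℕ; _≤_; _*_; suc)
open import Data.Product using (∃-syntax)
open import Relation.Binary.PropositionalEquality using (_≡_)

open import Data.Bool using (Bool; true; false; not; _xor_) renaming (_≟_ to _≟ᵇ_)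
open import Data.Bool.Properties using (not-distribˡ-xor; xor-same; xor-identityʳ; xor-comm; xor-assoc; not-involutive; ¬-not)
open import Data.Empty using (⊥-elim)
import Data.Fin as Fin
open import Data.Fin using (Fin; toℕ)
open import Data.Fin.Properties using (toℕ-fromℕ<; toℕ-injective; toℕ<n)
import Data.List as List
open import Data.List using (List; []; _∷_; _++_; map; reverse; length; filter; head; last; allFin)
open import Data.List.Properties using (length-map; length-++; length-tabulate; map-++; ++-assoc; ++-identityʳ; unfold-reverse; filter-all)
open import Data.List.Membership.Propositional using (_∈_; _∉_)
open import Data.List.Membership.Propositional.Properties using (∈-filter⁻; ∈-map⁺; ∈-map⁻)
open import Data.List.Relation.Binary.Permutation.Propositional using (_↭_; ↭-sym; ↭-trans; ↭-reflexive; prep; ↭⇒↭ₛ; module PermutationReasoning)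
open import Data.List.Relation.Binary.Permutation.Propositional.Properties using (shift; ∈-resp-↭; ↭-length; ↭-reverse; ++⁺ˡ; ++⁺ʳ; ++-comm)
import Data.List.Relation.Binary.Permutation.Setoid.Properties as PermutationSetoidProperties
open import Data.List.Relation.Unary.All as All using ()
open import Data.List.Relation.Unary.All.Properties using (¬Any⇒All¬)
open import Data.List.Relation.Unary.AllPairs using ([]; _∷_)
open import Data.List.Relation.Unary.Any using (here; there)
import Data.List.Relation.Unary.Any.Properties as Any
open import Data.List.Relation.Unary.Unique.Propositional using (Unique)
import Data.List.Relation.Unary.Unique.Propositional.Properties as Uniqueₚ
open import Data.Maybe using (Maybe; just; nothing)
open import Data.Nat using (zero; _+_; _∸_; _<_; z≤n; z<s; s≤s; s≤s⁻¹; NonZero; _<?_)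
open import Data.Nat.DivMod using (_%_; _/_; _mod_; m≡m%n+[m/n]*n; [m+kn]%n≡m%n; [m+n]%n≡m%n; m<n⇒m%n≡m; n%n≡0; m%n<n)
open import Data.Nat.Properties using (+-suc; +-comm; +-identityʳ; +-assoc; +-cancelˡ-<; +-monoˡ-<; m≤m*n; m≤n+m; m≤m+n; m<n+m; m+[n∸m]≡n; m≤n⇒∃[o]m+o≡n; <-cmp; ≤-trans; ≤-<-trans; ≤-reflexive; <-irrefl; ≤-antisym; ≮⇒≥)
open import Data.Nat.Tactic.RingSolver using (solve)
open import Data.Product using (_×_; _,_; proj₁; proj₂)
open import Data.Sum using (_⊎_; inj₁; inj₂; [_,_]′)
open import Data.Sum.Properties using (inj₁-injective; inj₂-injective; ≡-dec)
open import Data.Unit using (tt)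
import Data.Unit as Unit
open import Function using (_on_; _∘_)
open import Relation.Binary.Definitions using (DecidableEquality; Tri; tri<; tri≈; tri>)
open import Relation.Binary.PropositionalEquality using (refl; sym; trans; cong; cong₂; subst; subst₂; setoid; module ≡-Reasoning)
open import Relation.Nullary using (¬_; ¬?; yes; no)

module _ {A : Set} (_≟_ : DecidableEquality A) where

  private
    _without_ : List A → A → List A
    xs without x = filter (λ y → ¬? (y ≟ x)) xs

    ∈-without⁻ : ∀ {xs x y} → y ∈ xs without x → y ∈ xs × ¬ y ≡ x
    ∈-without⁻ {x = x} = ∈-filter⁻ (λ y → ¬? (y ≟ x))

    without-⊆ : ∀ {xs y ys} → (∀ {a} → a ∈ xs → a ∈ y ∷ ys) → ∀ {a} → a ∈ xs without y → a ∈ ys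
    without-⊆ xs⊆y∷ys a∈ with a∈xs , a≢y ← ∈-without⁻ a∈ with xs⊆y∷ys a∈xs
    ... | here a≡y = ⊥-elim (a≢y a≡y)
    ... | there a∈ys = a∈ys

    unique-without : ∀ {xs} x → Unique xs → Unique (xs without x)
    unique-without x = Uniqueₚ.filter⁺ (λ y → ¬? (y ≟ x))

    length-without : ∀ {xs} x → Unique xs → length xs ≤ suc (length (xs without x))
    length-without {[]} x _ = z≤n
    length-without {y ∷ xs} x (y∉xs ∷ u) with y ≟ x
    ... | yes refl = s≤s (≤-reflexive (cong length (sym (filter-all (λ y → ¬? (y ≟ x)) xs≢x))))
      where
      xs≢x : All.All (λ z → ¬ z ≡ x) xs
      xs≢x = All.map (λ x≢z z≡x → x≢z (sym z≡x)) y∉xs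
    ... | no _ = s≤s (length-without x u)

  ⊆-length : ∀ {xs ys} → Unique xs → (∀ {a} → a ∈ xs → a ∈ ys) → length xs ≤ length ys
  ⊆-length {[]} _ _ = z≤n
  ⊆-length {x ∷ xs} {[]} _ xs⊆ys with () ← xs⊆ys (here refl)
  ⊆-length {xs} {y ∷ ys} u xs⊆ys =
    ≤-trans (length-without y u) (s≤s (⊆-length (unique-without y u) (without-⊆ xs⊆ys)))

  covering⇒unique : ∀ {xs ys} → Unique xs → (∀ {a} → a ∈ xs → a ∈ ys) → length ys ≤ length xs → Unique ys
  covering⇒unique {xs} {[]} _ _ _ = []
  covering⇒unique {xs} {y ∷ ys} u xs⊆y∷ys |y∷ys|≤|xs| =
    ¬Any⇒All¬ ys y∉ys ∷ covering⇒unique (unique-without y u) (without-⊆ xs⊆y∷ys) |ys|≤|xs∖y|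
    where
    y∉ys : y ∉ ys
    y∉ys y∈ys = <-irrefl refl (≤-trans |y∷ys|≤|xs| (⊆-length u xs⊆ys))
      where
      xs⊆ys : ∀ {a} → a ∈ xs → a ∈ ys
      xs⊆ys a∈ with xs⊆y∷ys a∈
      ... | here refl = y∈ys
      ... | there a∈ys = a∈ys
    |ys|≤|xs∖y| : length ys ≤ length (xs without y)
    |ys|≤|xs∖y| = s≤s⁻¹ (≤-trans |y∷ys|≤|xs| (length-without y u))

data Trail {A : Set} (R : A → A → Set) : A → A → List A → Set where
  [_] : ∀ a → Trail R a a (a ∷ [])
  _∷_ : ∀ {a b c xs} → R a b → Trail R b c xs → Trail R a c (a ∷ xs)

module _ {A : Set} {R : A → A → Set} where

  infixl 5 _++⟨_⟩_

  _++⟨_⟩_ : ∀ {a b c d xs ys} → Trail R a b xs → R b c → Trail R c d ys → Trail R a d (xs ++ ys)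
  [ a ] ++⟨ e ⟩ τ = e ∷ τ
  (e′ ∷ σ) ++⟨ e ⟩ τ = e′ ∷ (σ ++⟨ e ⟩ τ)

  reverseᵗ : ∀ {a b xs} → (∀ {x y} → R x y → R y x) → Trail R a b xs → Trail R b a (reverse xs)
  reverseᵗ _ [ a ] = [ a ]
  reverseᵗ R-sym (_∷_ {a} {c = c} {xs} e τ) =
    subst (Trail R c a) (sym (unfold-reverse a xs)) (reverseᵗ R-sym τ ++⟨ R-sym e ⟩ [ a ])

mapᵗ : ∀ {A B : Set} {R : B → B → Set} {f : A → B} {a b xs} → Trail (R on f) a b xs → Trail R (f a) (f b) (map f xs)
mapᵗ [ a ] = [ _ ]
mapᵗ (e ∷ τ) = e ∷ mapᵗ τ

module _ {G : Graph} where

  trail⇒walk : ∀ {u v xs} → Trail (Adj G) u v xs → Walk G xs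
  trail⇒walk [ a ] = [ a ]
  trail⇒walk (e ∷ [ b ]) = e ∷ [ b ]
  trail⇒walk (e ∷ τ@(_ ∷ _)) = e ∷ trail⇒walk τ

  head-trail : ∀ {u v xs} → Trail (Adj G) u v xs → head xs ≡ just u
  head-trail [ a ] = refl
  head-trail (e ∷ τ) = refl

  last-trail : ∀ {u v xs} → Trail (Adj G) u v xs → last xs ≡ just v
  last-trail [ a ] = refl
  last-trail (e ∷ [ b ]) = refl
  last-trail (e ∷ τ@(_ ∷ _)) = last-trail τ

  walk⇒trail : ∀ {u v xs} → Walk G xs → head xs ≡ just u → last xs ≡ just v → Trail (Adj G) u v xs
  walk⇒trail [ a ] refl refl = [ a ]
  walk⇒trail (e ∷ w) refl l = e ∷ walk⇒trail w refl l

  HamPath-reverse : (∀ {x y} → Adj G x y → Adj G y x) → ∀ {u v} → HamPath G u v → HamPath G v u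
  HamPath-reverse Adj-sym π = record
    { path = reverse path
    ; walk = trail⇒walk τ
    ; unique = Unique-resp-↭ (↭⇒↭ₛ (↭-sym (↭-reverse path))) unique
    ; covers = λ w → Any.reverse⁺ (covers w)
    ; starts = head-trail τ
    ; ends = last-trail τ
    }
    where
    open HamPath π
    open PermutationSetoidProperties (setoid (V G)) using (Unique-resp-↭)
    τ : Trail (Adj G) _ _ (reverse path)
    τ = reverseᵗ Adj-sym (walk⇒trail walk starts ends)

  spanning-trail⇒HamPath : DecidableEquality (V G) → ∀ {u v xs ys} → Unique ys → length xs ≤ length ys →
                           Trail (Adj G) u v xs → (∀ w → w ∈ xs) → HamPath G u v
  spanning-trail⇒HamPath _≟_ {xs = xs} ys-unique |xs|≤|ys| τ spans = record
    { path = xs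
    ; walk = trail⇒walk τ
    ; unique = covering⇒unique _≟_ ys-unique (λ _ → spans _) |xs|≤|ys|
    ; covers = spans
    ; starts = head-trail τ
    ; ends = last-trail τ
    }

module _ {A B : Set} where

  unique-⊎ : ∀ {as : List A} {bs : List B} → Unique as → Unique bs → Unique (map inj₁ as ++ map inj₂ bs)
  unique-⊎ as-unique bs-unique =
    Uniqueₚ.++⁺ (Uniqueₚ.map⁺ inj₁-injective as-unique) (Uniqueₚ.map⁺ inj₂-injective bs-unique) disjoint
    where
    disjoint : ∀ {w} → ¬ (w ∈ map inj₁ _ × w ∈ map inj₂ _)
    disjoint (w∈as , w∈bs) with ∈-map⁻ inj₁ w∈as | ∈-map⁻ inj₂ w∈bs
    ... | _ , _ , refl | _ , _ , ()

myVertices : {A : Set} → List A → List (MyVert A)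
myVertices xs = map inj₁ xs ++ map inj₂ (map inj₁ xs ++ map inj₂ (tt ∷ []))

myVertices-unique : ∀ {A : Set} {xs : List A} → Unique xs → Unique (myVertices xs)
myVertices-unique u = unique-⊎ u (unique-⊎ u (All.[] ∷ []))

length-myVertices : ∀ {A : Set} (xs : List A) → length (myVertices xs) ≡ length xs + (length xs + 1)
length-myVertices xs =
  trans (length-++ (map inj₁ xs))
    (cong₂ _+_ (length-map inj₁ xs)
       (trans (length-map inj₂ (map inj₁ xs ++ map inj₂ (tt ∷ [])))
          (trans (length-++ (map inj₁ xs)) (cong (_+ 1) (length-map inj₁ xs)))))

Mycielskian-sym : ∀ {G} → (∀ {a b} → Adj G a b → Adj G b a) →
                  ∀ {a b} → Adj (Mycielskian G) a b → Adj (Mycielskian G) b a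
Mycielskian-sym G-sym {inj₁ _}        {inj₁ _}        e = G-sym e
Mycielskian-sym G-sym {inj₁ _}        {inj₂ (inj₁ _)} e = G-sym e
Mycielskian-sym G-sym {inj₂ (inj₁ _)} {inj₁ _}        e = G-sym e
Mycielskian-sym G-sym {inj₂ (inj₁ _)} {inj₂ (inj₂ _)} e = tt
Mycielskian-sym G-sym {inj₂ (inj₂ _)} {inj₂ (inj₁ _)} e = tt

cycleAdj-sym : ∀ {n} {i j : Fin n} → cycleAdj n i j → cycleAdj n j i
cycleAdj-sym = [ inj₂ , inj₁ ]′

[1+m]%n≡[1+m%n]%n : ∀ m n .{{_ : NonZero n}} → suc m % n ≡ suc (m % n) % n
[1+m]%n≡[1+m%n]%n m n =
  trans (cong (λ t → suc t % n) (m≡m%n+[m/n]*n m n)) ([m+kn]%n≡m%n (suc (m % n)) (m / n) n)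

cycleAdj-mod : ∀ n .{{_ : NonZero n}} j → cycleAdj n (j mod n) (suc j mod n)
cycleAdj-mod n j with suc (j % n) <? n
... | yes j%n+1<n = inj₁ (inj₁ (begin
      toℕ (suc j mod n) ≡⟨ toℕ-fromℕ< _ ⟩
      suc j % n         ≡⟨ [1+m]%n≡[1+m%n]%n j n ⟩
      suc (j % n) % n   ≡⟨ m<n⇒m%n≡m j%n+1<n ⟩
      suc (j % n)       ≡⟨ cong suc (toℕ-fromℕ< _) ⟨
      suc (toℕ (j mod n)) ∎))
  where open ≡-Reasoning
... | no j%n+1≮n = inj₁ (inj₂ (trans (cong suc (toℕ-fromℕ< _)) j%n+1≡n , (begin
      toℕ (suc j mod n) ≡⟨ toℕ-fromℕ< _ ⟩
      suc j % n         ≡⟨ [1+m]%n≡[1+m%n]%n j n ⟩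
      suc (j % n) % n   ≡⟨ cong (_% n) j%n+1≡n ⟩
      n % n             ≡⟨ n%n≡0 n ⟩
      0                 ∎)))
  where
  open ≡-Reasoning
  j%n+1≡n : suc (j % n) ≡ n
  j%n+1≡n = ≤-antisym (m%n<n j n) (≮⇒≥ j%n+1≮n)

m<n⇒∃[o]m+[1+o]≡n : ∀ {m n} → m < n → ∃[ o ] m + suc o ≡ n
m<n⇒∃[o]m+[1+o]≡n {m} m<n with o , m+1+o≡n ← m≤n⇒∃[o]m+o≡n m<n = o , trans (+-suc m o) m+1+o≡n

m+n≡o⇒o+o≡m+[o+n] : ∀ {m n o} → m + n ≡ o → o + o ≡ m + (o + n)
m+n≡o⇒o+o≡m+[o+n] {m} {n} refl = solve (m List.∷ n List.∷ List.[])

m+[1+n]≡o⇒[1+m+o]+n≡o+o : ∀ {m n o} → m + suc n ≡ o → suc (m + o) + n ≡ o + o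
m+[1+n]≡o⇒[1+m+o]+n≡o+o {m} {n} refl = solve (m List.∷ n List.∷ List.[])

m+[1+n]≡o⇒m+o+n+[1+o]≡o+[o+o] : ∀ {m n o} → m + suc n ≡ o → m + o + n + suc o ≡ o + (o + o)
m+[1+n]≡o⇒m+o+n+[1+o]≡o+[o+o] {m} {n} refl = solve (m List.∷ n List.∷ List.[])

interval : ℕ → ℕ → List ℕ
interval a zero = []
interval a (suc k) = a ∷ interval (suc a) k

length-interval : ∀ a k → length (interval a k) ≡ k
length-interval a zero = refl
length-interval a (suc k) = cong suc (length-interval (suc a) k)

∈-interval : ∀ a {k r} → r < k → a + r ∈ interval a k
∈-interval a {suc k} {zero} _ = here (+-identityʳ a)
∈-interval a {suc k} {suc r} (s≤s r<k) = there (subst (_∈ interval (suc a) k) (sym (+-suc a r)) (∈-interval (suc a) r<k))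

interval-++ : ∀ a k l {b} → a + k ≡ b → interval a (k + l) ≡ interval a k ++ interval b l
interval-++ a zero l refl = cong (λ b → interval b l) (sym (+-identityʳ a))
interval-++ a (suc k) l refl =
  cong (a ∷_) (trans (interval-++ (suc a) k l refl) (cong (λ b → interval (suc a) k ++ interval b l) (sym (+-suc a k))))

odd? : ℕ → Bool
odd? zero = false
odd? (suc k) = not (odd? k)

odd?-+ : ∀ a b → odd? (a + b) ≡ odd? a xor odd? b
odd?-+ zero b = refl
odd?-+ (suc a) b = trans (cong not (odd?-+ a b)) (not-distribˡ-xor (odd? a) (odd? b))

odd?-1+2k : ∀ k → odd? (suc (2 * k)) ≡ true
odd?-1+2k k = cong not (trans (cong (λ l → odd? (k + l)) (+-identityʳ k)) (trans (odd?-+ k k) (xor-same (odd? k))))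

even-or-odd : ∀ k → odd? k ≡ false ⊎ odd? k ≡ true
even-or-odd k with odd? k
... | false = inj₁ refl
... | true  = inj₂ refl

odd?-pred : ∀ k {b} → odd? (suc k) ≡ not b → odd? k ≡ b
odd?-pred k {b} e = trans (sym (not-involutive (odd? k))) (trans (cong not e) (not-involutive b))

odd?-+-cancelˡ : ∀ a b {x y} → odd? (a + b) ≡ x → odd? a ≡ y → odd? b ≡ y xor x
odd?-+-cancelˡ a b refl refl = begin
  odd? b                               ≡⟨ cong (_xor odd? b) (xor-same (odd? a)) ⟨
  (odd? a xor odd? a) xor odd? b       ≡⟨ xor-assoc (odd? a) (odd? a) (odd? b) ⟩
  odd? a xor (odd? a xor odd? b)       ≡⟨ cong (odd? a xor_) (odd?-+ a b) ⟨
  odd? a xor odd? (a + b)              ∎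
  where open ≡-Reasoning

module OddCycle (m : ℕ) (n-odd : odd? (3 + m) ≡ true) where

  n N : ℕ
  n = 3 + m
  N = n + n

  m-even : odd? m ≡ false
  m-even = not³-true (odd? m) n-odd
    where
    not³-true : ∀ b → not (not (not b)) ≡ true → b ≡ false
    not³-true false _ = refl

  N-even : odd? N ≡ false
  N-even = trans (odd?-+ n n) (xor-same (odd? n))

  μC : Graph
  μC = Mycielskian (Cycle n)

  z : MyVert (Fin n)
  z = inj₂ (inj₂ tt)

  layer : Bool → Fin n → MyVert (Fin n)
  layer false i = inj₁ i
  layer true  i = inj₂ (inj₁ i)

  spine : ℕ → MyVert (Fin n)
  spine j = layer (odd? j) (j mod n)

  μC-sym : ∀ {a b} → Adj μC a b → Adj μC b a
  μC-sym {a} {b} = Mycielskian-sym {Cycle n} cycleAdj-sym {a} {b}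

  μC-reverse : ∀ {u v} → HamPath μC u v → HamPath μC v u
  μC-reverse = HamPath-reverse (λ {a} {b} → μC-sym {a} {b})

  mod-cong : ∀ a b → a % n ≡ b % n → a mod n ≡ b mod n
  mod-cong _ _ a%n≡b%n = toℕ-injective (trans (toℕ-fromℕ< _) (trans a%n≡b%n (sym (toℕ-fromℕ< _))))

  toℕ-mod : ∀ (i : Fin n) → toℕ i mod n ≡ i
  toℕ-mod i = toℕ-injective (trans (toℕ-fromℕ< _) (m<n⇒m%n≡m (toℕ<n i)))

  spine≡layer : ∀ j {b} → odd? j ≡ b → spine j ≡ layer b (j mod n)
  spine≡layer j = cong (λ b → layer b (j mod n))

  spine-step : ∀ j → Adj μC (spine j) (spine (suc j))
  spine-step j with odd? j
  ... | false = cycleAdj-mod n j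
  ... | true  = cycleAdj-mod n j

  spine-chord : ∀ j → odd? j ≡ false → Adj μC (spine j) (spine (j + suc n))
  spine-chord j j-even =
    subst₂ (Adj μC) (sym (spine≡layer j j-even)) (sym (spine≡layer (j + suc n) j+n+1-even))
      (subst (cycleAdj n _) j+n+1≡j+1 (cycleAdj-mod n j))
    where
    j+n+1-even : odd? (j + suc n) ≡ false
    j+n+1-even = trans (odd?-+ j (suc n)) (cong₂ _xor_ j-even (cong not n-odd))
    j+n+1≡j+1 : suc j mod n ≡ (j + suc n) mod n
    j+n+1≡j+1 = mod-cong (suc j) (j + suc n) (sym (trans (cong (_% n) (+-suc j n)) ([m+n]%n≡m%n (suc j) n)))

  spine-z : ∀ j → odd? j ≡ true → Adj μC (spine j) z
  spine-z j j-odd rewrite j-odd = tt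

  spine-periodic : ∀ j → spine (j + N) ≡ spine j
  spine-periodic j rewrite odd?-+ j N | odd?-+ n n | xor-same (odd? n) | xor-identityʳ (odd? j)
    = cong (layer (odd? j)) (mod-cong (j + N) j j+2n%n≡j%n)
    where
    j+2n%n≡j%n : (j + N) % n ≡ j % n
    j+2n%n≡j%n = trans (cong (λ t → (j + (n + t)) % n) (sym (+-identityʳ n))) ([m+kn]%n≡m%n j 2 n)

  spine-periodic* : ∀ j k → spine (j + k * N) ≡ spine j
  spine-periodic* j zero = cong spine (+-identityʳ j)
  spine-periodic* j (suc k) = begin
    spine (j + (N + k * N)) ≡⟨ cong spine (+-assoc j N (k * N)) ⟨
    spine (j + N + k * N)   ≡⟨ spine-periodic* (j + N) k ⟩
    spine (j + N)           ≡⟨ spine-periodic j ⟩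
    spine j                 ∎
    where open ≡-Reasoning

  spine-window : ∀ c q → ∃[ r ] r < N × spine (c + r) ≡ spine q
  spine-window c q = s % N , m%n<n s N , (begin
    spine (c + s % N)                   ≡⟨ spine-periodic* (c + s % N) (s / N) ⟨
    spine (c + s % N + s / N * N)       ≡⟨ cong spine (+-assoc c (s % N) _) ⟩
    spine (c + (s % N + s / N * N))     ≡⟨ cong (λ t → spine (c + t)) (m≡m%n+[m/n]*n s N) ⟨
    spine (c + s)                       ≡⟨ cong spine (m+[n∸m]≡n c≤q+cN) ⟩
    spine (q + c * N)                   ≡⟨ spine-periodic* q c ⟩
    spine q                             ∎)
    where
    open ≡-Reasoning
    s : ℕ
    s = q + c * N ∸ c
    c≤q+cN : c ≤ q + c * N
    c≤q+cN = ≤-trans (m≤m*n c N) (m≤n+m (c * N) q)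

  spine-layer : ∀ b i → ∃[ j ] j < N × spine j ≡ layer b i
  spine-layer b i with odd? (toℕ i) ≟ᵇ b
  ... | yes i-parity =
    toℕ i , ≤-trans (toℕ<n i) (m≤m+n n n) , trans (spine≡layer (toℕ i) i-parity) (cong (layer b) (toℕ-mod i))
  ... | no ¬i-parity =
    toℕ i + n , +-monoˡ-< n (toℕ<n i) , trans (spine≡layer (toℕ i + n) i+n-parity) (cong (layer b) i+n-mod)
    where
    i+n-parity : odd? (toℕ i + n) ≡ b
    i+n-parity = trans (odd?-+ (toℕ i) n)
                   (trans (cong (odd? (toℕ i) xor_) n-odd) (trans (xor-comm _ true) (sym (¬-not (¬i-parity ∘ sym)))))
    i+n-mod : (toℕ i + n) mod n ≡ i
    i+n-mod = trans (mod-cong (toℕ i + n) (toℕ i) ([m+n]%n≡m%n (toℕ i) n)) (toℕ-mod i)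

  spine≡layer⇒parity : ∀ j {b i} → spine j ≡ layer b i → odd? j ≡ b
  spine≡layer⇒parity j {b} e = layer-injective (odd? j) b e
    where
    layer-injective : ∀ b b′ {i i′} → layer b i ≡ layer b′ i′ → b ≡ b′
    layer-injective false false _ = refl
    layer-injective true  true  _ = refl

  at : ℕ → Maybe ℕ → MyVert (Fin n)
  at p nothing = z
  at p (just k) = spine (p + k)

  Step : ℕ → Maybe ℕ → Maybe ℕ → Set
  Step p = Adj μC on at p

  offsets : ℕ → ℕ → List (Maybe ℕ)
  offsets a k = map just (interval a k)

  offsets-++ : ∀ a k l {b} → a + k ≡ b → offsets a (k + l) ≡ offsets a k ++ offsets b l
  offsets-++ a k l a+k≡b = trans (cong (map just) (interval-++ a k l a+k≡b)) (map-++ just (interval a k) _)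

  Step-sym : ∀ p {a b} → Step p a b → Step p b a
  Step-sym p {a} {b} = μC-sym {at p a} {at p b}

  step-edge : ∀ p k → Step p (just k) (just (suc k))
  step-edge p k = subst (Adj μC (spine (p + k))) (cong spine (sym (+-suc p k))) (spine-step (p + k))

  chord-edge : ∀ p {k k′} → odd? (p + k) ≡ false → k + suc n ≡ k′ → Step p (just k) (just k′)
  chord-edge p {k} p+k-even refl =
    subst (Adj μC (spine (p + k))) (cong spine (+-assoc p k (suc n))) (spine-chord (p + k) p+k-even)

  chord-edge-wrap : ∀ p {k k′} → odd? (p + k) ≡ false → k + suc n ≡ k′ + N → Step p (just k) (just k′)
  chord-edge-wrap p {k} {k′} p+k-even e =
    subst (Adj μC (spine (p + k))) p+k+n+1≡p+k′ (spine-chord (p + k) p+k-even)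
    where
    open ≡-Reasoning
    p+k+n+1≡p+k′ : spine (p + k + suc n) ≡ spine (p + k′)
    p+k+n+1≡p+k′ = begin
      spine (p + k + suc n)  ≡⟨ cong spine (trans (+-assoc p k (suc n)) (cong (p +_) e)) ⟩
      spine (p + (k′ + N))   ≡⟨ cong spine (+-assoc p k′ N) ⟨
      spine (p + k′ + N)     ≡⟨ spine-periodic (p + k′) ⟩
      spine (p + k′)         ∎

  into-z : ∀ p {k} → odd? (p + k) ≡ true → Step p (just k) nothing
  into-z p {k} = spine-z (p + k)

  out-of-z : ∀ p {k} → odd? (p + k) ≡ true → Step p nothing (just k)
  out-of-z p {k} p+k-odd = μC-sym {spine (p + k)} (spine-z (p + k) p+k-odd)

  ascending : ∀ p a k {b} → a + k ≡ b → Trail (Step p) (just a) (just b) (offsets a (suc k))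
  ascending p a zero refl =
    subst (λ b → Trail (Step p) (just a) (just b) (just a ∷ [])) (sym (+-identityʳ a)) [ just a ]
  ascending p a (suc k) refl = step-edge p a ∷ ascending p (suc a) k (sym (+-suc a k))

  descending : ∀ p a k {b} → a + k ≡ b → Trail (Step p) (just b) (just a) (reverse (offsets a (suc k)))
  descending p a k a+k≡b = reverseᵗ (λ {x} {y} → Step-sym p {x} {y}) (ascending p a k a+k≡b)

  -- The routes below are displayed as their sequences of offsets from p; offset N is position p again.
  record Plan (p : ℕ) (s t : Maybe ℕ) : Set where
    field
      start  : ℕ
      before : List (Maybe ℕ)
      after  : List (Maybe ℕ)
      trail  : Trail (Step p) s t (before ++ nothing ∷ after)
      visits : before ++ after ↭ offsets start N

  plan⇒HamPath : ∀ {p s t u v} → Plan p s t → at p s ≡ u → at p t ≡ v → HamPath μC u v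
  plan⇒HamPath {p} P refl refl =
    spanning-trail⇒HamPath _≟_ (myVertices-unique (Uniqueₚ.allFin⁺ n)) |route|≤|V| (mapᵗ trail) spans
    where
    open Plan P
    route : List (Maybe ℕ)
    route = before ++ nothing ∷ after
    _≟_ : DecidableEquality (MyVert (Fin n))
    _≟_ = ≡-dec Fin._≟_ (≡-dec Fin._≟_ Unit._≟_)
    route↭ : route ↭ nothing ∷ offsets start N
    route↭ = ↭-trans (shift nothing before after) (prep nothing visits)
    visited : ∀ {o} → o ∈ nothing ∷ offsets start N → at p o ∈ map (at p) route
    visited o∈ = ∈-map⁺ (at p) (∈-resp-↭ (↭-sym route↭) o∈)
    spine-visited : ∀ q → spine q ∈ map (at p) route
    spine-visited q with r , r<N , e ← spine-window (p + start) q =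
      subst (_∈ _) (trans (cong spine (sym (+-assoc p start r))) e) (visited (there (∈-map⁺ just (∈-interval start r<N))))
    spans : ∀ w → w ∈ map (at p) route
    spans (inj₁ i)         with j , _ , e ← spine-layer false i = subst (_∈ _) e (spine-visited j)
    spans (inj₂ (inj₁ i))  with j , _ , e ← spine-layer true i = subst (_∈ _) e (spine-visited j)
    spans (inj₂ (inj₂ tt)) = visited (here refl)
    |route|≤|V| : length (map (at p) route) ≤ length (myVertices (allFin n))
    |route|≤|V| = ≤-reflexive (begin
      length (map (at p) route)                    ≡⟨ length-map (at p) route ⟩
      length route                                 ≡⟨ ↭-length route↭ ⟩
      suc (length (offsets start N))               ≡⟨ cong suc (length-map just (interval start N)) ⟩
      suc (length (interval start N))              ≡⟨ cong suc (length-interval start N) ⟩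
      suc (n + n)                                  ≡⟨ trans (cong (n +_) (+-comm n 1)) (+-suc n n) ⟨
      n + (n + 1)                                  ≡⟨ cong (λ k → k + (k + 1)) (length-tabulate {n = n} (λ i → i)) ⟨
      length (allFin n) + (length (allFin n) + 1)  ≡⟨ length-myVertices (allFin n) ⟨
      length (myVertices (allFin n))               ∎)
      where open ≡-Reasoning

  -- N, N − 1, …, 1, z
  path-x-z : ∀ p → odd? p ≡ false → HamPath μC (spine p) z
  path-x-z p p-even = plan⇒HamPath plan (spine-periodic p) refl
    where
    p+1-odd : odd? (p + 1) ≡ true
    p+1-odd rewrite odd?-+ p 1 | p-even = refl
    plan : Plan p (just N) nothing
    plan = record
      { start = 1 ; before = reverse (offsets 1 N) ; after = []
      ; trail = descending p 1 (suc (suc (m + n))) refl ++⟨ into-z p p+1-odd ⟩ [ nothing ]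
      ; visits = ↭-trans (↭-reflexive (++-identityʳ _)) (↭-reverse (offsets 1 N))
      }

  -- 0, 1, …, m + 1, n + m + 2, …, m + 2, z
  path-y-z : ∀ p → odd? p ≡ true → HamPath μC (spine p) z
  path-y-z p p-odd = plan⇒HamPath plan (cong spine (+-identityʳ p)) refl
    where
    p+m+1-even : odd? (p + suc m) ≡ false
    p+m+1-even rewrite odd?-+ p (suc m) | p-odd | m-even = refl
    p+m+2-odd : odd? (p + suc (suc m)) ≡ true
    p+m+2-odd rewrite odd?-+ p (suc (suc m)) | p-odd | m-even = refl
    A B : List (Maybe ℕ)
    A = offsets 0 (suc (suc m))
    B = offsets (suc (suc m)) (suc n)
    plan : Plan p (just 0) nothing
    plan = record
      { start = 0 ; before = A ++ reverse B ; after = []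
      ; trail = ascending p 0 (suc m) refl ++⟨ chord-edge p p+m+1-even (+-suc (suc m) n) ⟩
                descending p (suc (suc m)) n refl ++⟨ into-z p p+m+2-odd ⟩ [ nothing ]
      ; visits = begin
          (A ++ reverse B) ++ []           ≡⟨ ++-identityʳ _ ⟩
          A ++ reverse B                   ↭⟨ ++⁺ˡ A (↭-reverse B) ⟩
          A ++ B                           ≡⟨ offsets-++ 0 (suc (suc m)) (suc n) refl ⟨
          offsets 0 (suc (suc m) + suc n)  ≡⟨ cong (λ k → offsets 0 (suc (suc k))) (+-suc m n) ⟩
          offsets 0 N                      ∎
      }
      where open PermutationReasoning

  -- N, N − 1, …, d + 2, z, 1, 2, …, d + 1
  path-x-x : ∀ p d → odd? p ≡ false → odd? d ≡ true → suc d < N → HamPath μC (spine p) (spine (p + suc d))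
  path-x-x p d p-even d-odd d+1<N with e , d+e+2≡N ← m<n⇒∃[o]m+[1+o]≡n d+1<N =
    plan⇒HamPath plan (spine-periodic p) refl
    where
    p+d+2-odd : odd? (p + suc (suc d)) ≡ true
    p+d+2-odd rewrite odd?-+ p (suc (suc d)) | p-even | d-odd = refl
    p+1-odd : odd? (p + 1) ≡ true
    p+1-odd rewrite odd?-+ p 1 | p-even = refl
    near far : List (Maybe ℕ)
    near = offsets 1 (suc d)
    far = offsets (suc (suc d)) (suc e)
    plan : Plan p (just N) (just (suc d))
    plan = record
      { start = 1 ; before = reverse far ; after = near
      ; trail = descending p (suc (suc d)) e (trans (sym (+-suc (suc d) e)) d+e+2≡N) ++⟨ into-z p p+d+2-odd ⟩
                (out-of-z p p+1-odd ∷ ascending p 1 d refl)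
      ; visits = begin
          reverse far ++ near         ↭⟨ ++⁺ʳ near (↭-reverse far) ⟩
          far ++ near                 ↭⟨ ++-comm far near ⟩
          near ++ far                 ≡⟨ offsets-++ 1 (suc d) (suc e) refl ⟨
          offsets 1 (suc d + suc e)   ≡⟨ cong (offsets 1) d+e+2≡N ⟩
          offsets 1 N                 ∎
      }
      where open PermutationReasoning

  -- 0, 1, …, c, c + n + 1, …, N − 1, z, c + n, …, c + 1
  path-x-y-near : ∀ p c → odd? p ≡ false → odd? c ≡ false → suc c < n → HamPath μC (spine p) (spine (p + suc c))
  path-x-y-near p c p-even c-even c+1<n with e , c+e+2≡n ← m<n⇒∃[o]m+[1+o]≡n c+1<n =
    plan⇒HamPath plan (cong spine (+-identityʳ p)) refl
    where
    d : ℕ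
    d = suc c
    e-odd : odd? e ≡ true
    e-odd = odd?-pred e (odd?-+-cancelˡ d (suc e) (trans (cong odd? c+e+2≡n) n-odd) (cong not c-even))
    p+c-even : odd? (p + c) ≡ false
    p+c-even rewrite odd?-+ p c | p-even | c-even = refl
    p+N-1-odd : odd? (p + (d + n + e)) ≡ true
    p+N-1-odd rewrite odd?-+ p (d + n + e) | odd?-+ (d + n) e | odd?-+ d n | p-even | c-even | n-odd | e-odd = refl
    p+d+n-1-odd : odd? (p + (d + suc (suc m))) ≡ true
    p+d+n-1-odd rewrite odd?-+ p (d + suc (suc m)) | odd?-+ d (suc (suc m)) | p-even | c-even | m-even = refl
    A B D : List (Maybe ℕ)
    A = offsets 0 d
    B = offsets d n
    D = offsets (d + n) (suc e)
    N≡d+[n+e+1] : N ≡ d + (n + suc e)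
    N≡d+[n+e+1] = m+n≡o⇒o+o≡m+[o+n] {d} {suc e} c+e+2≡n
    plan : Plan p (just 0) (just d)
    plan = record
      { start = 0 ; before = A ++ D ; after = reverse B
      ; trail = ascending p 0 c refl ++⟨ chord-edge p p+c-even (+-suc c n) ⟩
                ascending p (d + n) e refl ++⟨ into-z p p+N-1-odd ⟩
                (out-of-z p p+d+n-1-odd ∷ descending p d (suc (suc m)) refl)
      ; visits = begin
          (A ++ D) ++ reverse B        ≡⟨ ++-assoc A D _ ⟩
          A ++ D ++ reverse B          ↭⟨ ++⁺ˡ A (++-comm D (reverse B)) ⟩
          A ++ reverse B ++ D          ↭⟨ ++⁺ˡ A (++⁺ʳ D (↭-reverse B)) ⟩
          A ++ B ++ D                  ≡⟨ cong (A ++_) (offsets-++ d n (suc e) refl) ⟨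
          A ++ offsets d (n + suc e)   ≡⟨ offsets-++ 0 d (n + suc e) refl ⟨
          offsets 0 (d + (n + suc e))  ≡⟨ cong (offsets 0) N≡d+[n+e+1] ⟨
          offsets 0 N                  ∎
      }
      where open PermutationReasoning

  -- 0, 1, z, N − 1, …, n + 1, 2, 3, …, n
  path-x-y-opposite : ∀ p → odd? p ≡ false → HamPath μC (spine p) (spine (p + n))
  path-x-y-opposite p p-even = plan⇒HamPath plan (cong spine (+-identityʳ p)) refl
    where
    k : ℕ
    k = suc (suc m)
    p+1-odd : odd? (p + 1) ≡ true
    p+1-odd rewrite odd?-+ p 1 | p-even = refl
    p+N-1-odd : odd? (p + (suc n + suc m)) ≡ true
    p+N-1-odd rewrite odd?-+ p (suc n + suc m) | odd?-+ (suc n) (suc m) | p-even | m-even = refl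
    p+n+1-even : odd? (p + suc n) ≡ false
    p+n+1-even rewrite odd?-+ p (suc n) | p-even | m-even = refl
    A C D : List (Maybe ℕ)
    A = offsets 0 2
    C = offsets 2 k
    D = offsets (suc n) k
    plan : Plan p (just 0) (just n)
    plan = record
      { start = 0 ; before = A ; after = reverse D ++ C
      ; trail = ascending p 0 1 refl ++⟨ into-z p p+1-odd ⟩
                (out-of-z p p+N-1-odd ∷
                  (descending p (suc n) (suc m) refl ++⟨ chord-edge-wrap p p+n+1-even (cong suc (+-suc n n)) ⟩
                   ascending p 2 (suc m) refl))
      ; visits = begin
          A ++ reverse D ++ C      ↭⟨ ++⁺ˡ A (++⁺ʳ C (↭-reverse D)) ⟩
          A ++ D ++ C              ↭⟨ ++⁺ˡ A (++-comm D C) ⟩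
          A ++ C ++ D              ≡⟨ cong (A ++_) (offsets-++ 2 k k refl) ⟨
          A ++ offsets 2 (k + k)   ≡⟨ offsets-++ 0 2 (k + k) refl ⟨
          offsets 0 (2 + (k + k))  ≡⟨ cong (λ l → offsets 0 (suc (suc (suc l)))) (+-suc m (suc (suc m))) ⟨
          offsets 0 N              ∎
      }
      where open PermutationReasoning

  -- N, N − 1, …, f + n + 2, f + 1, f, …, 1, z, f + 2, …, f + n + 1
  path-x-y-far : ∀ p f g → odd? p ≡ false → odd? f ≡ true → suc f + suc g ≡ n →
                 HamPath μC (spine p) (spine (p + (suc f + n)))
  path-x-y-far p f g p-even f-odd f+g+2≡n = plan⇒HamPath plan (spine-periodic p) refl
    where
    d : ℕ
    d = suc f + n
    p+f+1-even : odd? (p + suc f) ≡ false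
    p+f+1-even rewrite odd?-+ p (suc f) | p-even | f-odd = refl
    p+1-odd : odd? (p + 1) ≡ true
    p+1-odd rewrite odd?-+ p 1 | p-even = refl
    p+f+2-odd : odd? (p + suc (suc f)) ≡ true
    p+f+2-odd rewrite odd?-+ p (suc (suc f)) | p-even | f-odd = refl
    A B C : List (Maybe ℕ)
    A = offsets 1 (suc f)
    B = offsets (suc (suc f)) n
    C = offsets (suc d) (suc g)
    plan : Plan p (just N) (just d)
    plan = record
      { start = 1 ; before = reverse C ++ reverse A ; after = B
      ; trail = descending p (suc d) g (m+[1+n]≡o⇒[1+m+o]+n≡o+o {suc f} {g} f+g+2≡n)
                  ++⟨ Step-sym p {just (suc f)} {just (suc d)} (chord-edge p p+f+1-even (+-suc (suc f) n)) ⟩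
                descending p 1 f refl ++⟨ into-z p p+1-odd ⟩
                (out-of-z p p+f+2-odd ∷ ascending p (suc (suc f)) (suc (suc m)) (sym (+-suc (suc f) (suc (suc m)))))
      ; visits = begin
          (reverse C ++ reverse A) ++ B  ↭⟨ ++⁺ʳ B (++⁺ʳ (reverse A) (↭-reverse C)) ⟩
          (C ++ reverse A) ++ B          ↭⟨ ++⁺ʳ B (++⁺ˡ C (↭-reverse A)) ⟩
          (C ++ A) ++ B                  ≡⟨ ++-assoc C A B ⟩
          C ++ A ++ B                    ↭⟨ ++-comm C (A ++ B) ⟩
          (A ++ B) ++ C                  ≡⟨ ++-assoc A B C ⟩
          A ++ B ++ C                    ≡⟨ cong (A ++_) (offsets-++ (suc (suc f)) n (suc g) refl) ⟨
          A ++ offsets (suc (suc f)) (n + suc g)  ≡⟨ offsets-++ 1 (suc f) (n + suc g) refl ⟨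
          offsets 1 (suc f + (n + suc g))         ≡⟨ cong (offsets 1) (m+n≡o⇒o+o≡m+[o+n] {suc f} {suc g} f+g+2≡n) ⟨
          offsets 1 N                             ∎
      }
      where open PermutationReasoning

  -- 0, 1, …, c, c + n + 1, …, N − 1, n, …, n + c, z, n − 1, …, c + 1
  path-y-y-near : ∀ p c → odd? p ≡ true → odd? c ≡ true → suc c < n → HamPath μC (spine p) (spine (p + suc c))
  path-y-y-near p c p-odd c-odd c+1<n with e , c+e+2≡n ← m<n⇒∃[o]m+[1+o]≡n c+1<n =
    plan⇒HamPath plan (cong spine (+-identityʳ p)) refl
    where
    d : ℕ
    d = suc c
    e-even : odd? e ≡ false
    e-even = odd?-pred e (odd?-+-cancelˡ d (suc e) (trans (cong odd? c+e+2≡n) n-odd) (cong not c-odd))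
    p+c-even : odd? (p + c) ≡ false
    p+c-even rewrite odd?-+ p c | p-odd | c-odd = refl
    p+N-1-even : odd? (p + (d + n + e)) ≡ false
    p+N-1-even rewrite odd?-+ p (d + n + e) | odd?-+ (d + n) e | odd?-+ d n | p-odd | c-odd | n-odd | e-even = refl
    p+n+c-odd : odd? (p + (n + c)) ≡ true
    p+n+c-odd rewrite odd?-+ p (n + c) | odd?-+ n c | p-odd | c-odd | n-odd = refl
    p+d+e-odd : odd? (p + (d + e)) ≡ true
    p+d+e-odd rewrite odd?-+ p (d + e) | odd?-+ d e | p-odd | c-odd | e-even = refl
    A B C D : List (Maybe ℕ)
    A = offsets 0 d
    B = offsets d (suc e)
    C = offsets n d
    D = offsets (d + n) (suc e)
    N≡A+B+C+D : offsets 0 N ≡ A ++ B ++ C ++ D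
    N≡A+B+C+D = begin
      offsets 0 N                                ≡⟨ cong (λ k → offsets 0 (k + k)) c+e+2≡n ⟨
      offsets 0 ((d + suc e) + (d + suc e))      ≡⟨ cong (offsets 0) (+-assoc d (suc e) _) ⟩
      offsets 0 (d + (suc e + (d + suc e)))      ≡⟨ offsets-++ 0 d _ refl ⟩
      A ++ offsets d (suc e + (d + suc e))       ≡⟨ cong (A ++_) (offsets-++ d (suc e) _ c+e+2≡n) ⟩
      A ++ B ++ offsets n (d + suc e)            ≡⟨ cong (λ l → A ++ B ++ l) (offsets-++ n d (suc e) (+-comm n d)) ⟩
      A ++ B ++ C ++ D                           ∎
      where open ≡-Reasoning
    plan : Plan p (just 0) (just d)
    plan = record
      { start = 0 ; before = (A ++ D) ++ C ; after = reverse B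
      ; trail = ascending p 0 c refl ++⟨ chord-edge p p+c-even (+-suc c n) ⟩
                ascending p (d + n) e refl
                  ++⟨ chord-edge-wrap p p+N-1-even (m+[1+n]≡o⇒m+o+n+[1+o]≡o+[o+o] {d} {e} c+e+2≡n) ⟩
                ascending p n c refl ++⟨ into-z p p+n+c-odd ⟩
                (out-of-z p p+d+e-odd ∷ descending p d e refl)
      ; visits = begin
          ((A ++ D) ++ C) ++ reverse B   ≡⟨ cong (_++ reverse B) (++-assoc A D C) ⟩
          (A ++ D ++ C) ++ reverse B     ≡⟨ ++-assoc A (D ++ C) _ ⟩
          A ++ (D ++ C) ++ reverse B     ↭⟨ ++⁺ˡ A (++-comm (D ++ C) (reverse B)) ⟩
          A ++ reverse B ++ D ++ C       ↭⟨ ++⁺ˡ A (++⁺ʳ (D ++ C) (↭-reverse B)) ⟩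
          A ++ B ++ D ++ C               ↭⟨ ++⁺ˡ A (++⁺ˡ B (++-comm D C)) ⟩
          A ++ B ++ C ++ D               ≡⟨ N≡A+B+C+D ⟨
          offsets 0 N                    ∎
      }
      where open PermutationReasoning

  path-x-y : ∀ p c → odd? p ≡ false → odd? c ≡ false → suc c < N → HamPath μC (spine p) (spine (p + suc c))
  path-x-y p c p-even c-even c+1<N with <-cmp (suc c) n
  ... | tri< c+1<n _ _ = path-x-y-near p c p-even c-even c+1<n
  ... | tri≈ _ c+1≡n _ = subst (λ k → HamPath μC (spine p) (spine (p + k))) (sym c+1≡n) (path-x-y-opposite p p-even)
  ... | tri> _ _ n<c+1 with f , n+f+1≡c+1 ← m<n⇒∃[o]m+[1+o]≡n n<c+1 =
    subst (λ k → HamPath μC (spine p) (spine (p + k))) f+1+n≡c+1 (path-x-y-far p f g p-even f-odd f+g+2≡n)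
    where
    f+1+n≡c+1 : suc f + n ≡ suc c
    f+1+n≡c+1 = trans (+-comm (suc f) n) n+f+1≡c+1
    f+1<n : suc f < n
    f+1<n = +-cancelˡ-< n (suc f) n (subst (_< N) (sym n+f+1≡c+1) c+1<N)
    g : ℕ
    g = proj₁ (m<n⇒∃[o]m+[1+o]≡n f+1<n)
    f+g+2≡n : suc f + suc g ≡ n
    f+g+2≡n = proj₂ (m<n⇒∃[o]m+[1+o]≡n f+1<n)
    f-odd : odd? f ≡ true
    f-odd = odd?-pred f (odd?-+-cancelˡ n (suc f) (trans (cong odd? n+f+1≡c+1) (cong not c-even)) n-odd)

  spine-around : ∀ p a b → a + b ≡ N → spine (p + a + b) ≡ spine p
  spine-around p a b a+b≡N = trans (cong spine (trans (+-assoc p a b) (cong (p +_) a+b≡N))) (spine-periodic p)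

  path-back-around : ∀ p a b → a + b ≡ N →
                     HamPath μC (spine (p + a)) (spine (p + a + b)) → HamPath μC (spine p) (spine (p + a))
  path-back-around p a b a+b≡N π = μC-reverse (subst (HamPath μC (spine (p + a))) (spine-around p a b a+b≡N) π)

  path-y-y : ∀ p c → odd? p ≡ true → odd? c ≡ true → suc c < N → HamPath μC (spine p) (spine (p + suc c))
  path-y-y p c p-odd c-odd c+1<N with <-cmp (suc c) n
  ... | tri< c+1<n _ _ = path-y-y-near p c p-odd c-odd c+1<n
  ... | tri≈ _ c+1≡n _ with () ← trans (sym (cong not c-odd)) (trans (cong odd? c+1≡n) n-odd)
  ... | tri> _ _ n<c+1 with e , c+e+2≡N ← m<n⇒∃[o]m+[1+o]≡n c+1<N =
    path-back-around p (suc c) (suc e) c+e+2≡N (path-y-y-near (p + suc c) e p+c+1-odd e-odd e+1<n)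
    where
    p+c+1-odd : odd? (p + suc c) ≡ true
    p+c+1-odd rewrite odd?-+ p (suc c) | p-odd | c-odd = refl
    e-odd : odd? e ≡ true
    e-odd = odd?-pred e (odd?-+-cancelˡ (suc c) (suc e) (trans (cong odd? c+e+2≡N) N-even) (cong not c-odd))
    e+1<n : suc e < n
    e+1<n = +-cancelˡ-< n (suc e) n (subst (n + suc e <_) c+e+2≡N (+-monoˡ-< (suc e) n<c+1))

  path-from : ∀ p d → suc d < N → HamPath μC (spine p) (spine (p + suc d))
  path-from p d d+1<N with even-or-odd p | even-or-odd d
  ... | inj₁ p-parity | inj₁ d-parity = path-x-y p d p-parity d-parity d+1<N
  ... | inj₁ p-parity | inj₂ d-parity = path-x-x p d p-parity d-parity d+1<N
  ... | inj₂ p-parity | inj₂ d-parity = path-y-y p d p-parity d-parity d+1<N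
  ... | inj₂ p-parity | inj₁ d-parity with e , d+e+2≡N ← m<n⇒∃[o]m+[1+o]≡n d+1<N =
    path-back-around p (suc d) (suc e) d+e+2≡N (path-x-y (p + suc d) e p+d+1-even e-even e+1<N)
    where
    p+d+1-even : odd? (p + suc d) ≡ false
    p+d+1-even rewrite odd?-+ p (suc d) | p-parity | d-parity = refl
    e-even : odd? e ≡ false
    e-even = odd?-pred e (odd?-+-cancelˡ (suc d) (suc e) (trans (cong odd? d+e+2≡N) N-even) (cong not d-parity))
    e+1<N : suc e < N
    e+1<N = subst (suc e <_) d+e+2≡N (m<n+m (suc e) z<s)

  path-to-z : ∀ b i → HamPath μC (layer b i) z
  path-to-z b i with j , _ , j↦v ← spine-layer b i =
    subst (λ v → HamPath μC v z) j↦v (from-parity b (spine≡layer⇒parity j j↦v))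
    where
    from-parity : ∀ b → odd? j ≡ b → HamPath μC (spine j) z
    from-parity false = path-x-z j
    from-parity true  = path-y-z j

  path-up : ∀ {j j′} → j < j′ → j′ < N → HamPath μC (spine j) (spine j′)
  path-up {j} j<j′ j′<N with d , j+d+1≡j′ ← m<n⇒∃[o]m+[1+o]≡n j<j′ =
    subst (λ k → HamPath μC (spine j) (spine k)) j+d+1≡j′ (path-from j d d+1<N)
    where
    d+1<N : suc d < N
    d+1<N = ≤-<-trans (m≤n+m (suc d) j) (subst (_< N) (sym j+d+1≡j′) j′<N)

  path-between : ∀ b i b′ i′ → ¬ layer b i ≡ layer b′ i′ → HamPath μC (layer b i) (layer b′ i′)
  path-between b i b′ i′ u≢v with j , j<N , j↦u ← spine-layer b i | j′ , j′<N , j′↦v ← spine-layer b′ i′ =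
    subst₂ (HamPath μC) j↦u j′↦v (path-between-positions (<-cmp j j′))
    where
    path-between-positions : Tri (j < j′) (j ≡ j′) (j′ < j) → HamPath μC (spine j) (spine j′)
    path-between-positions (tri< j<j′ _ _) = path-up j<j′ j′<N
    path-between-positions (tri≈ _ j≡j′ _) = ⊥-elim (u≢v (trans (sym j↦u) (trans (cong spine j≡j′) j′↦v)))
    path-between-positions (tri> _ _ j′<j) = μC-reverse (path-up j′<j j<N)

  hamiltonConnected : HamiltonConnected μC
  hamiltonConnected (inj₁ i)         (inj₁ i′)        u≢v = path-between false i false i′ u≢v
  hamiltonConnected (inj₁ i)         (inj₂ (inj₁ i′)) u≢v = path-between false i true i′ u≢v
  hamiltonConnected (inj₂ (inj₁ i))  (inj₁ i′)        u≢v = path-between true i false i′ u≢v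
  hamiltonConnected (inj₂ (inj₁ i))  (inj₂ (inj₁ i′)) u≢v = path-between true i true i′ u≢v
  hamiltonConnected (inj₁ i)         (inj₂ (inj₂ tt)) _   = path-to-z false i
  hamiltonConnected (inj₂ (inj₁ i))  (inj₂ (inj₂ tt)) _   = path-to-z true i
  hamiltonConnected (inj₂ (inj₂ tt)) (inj₁ i′)        _   = μC-reverse (path-to-z false i′)
  hamiltonConnected (inj₂ (inj₂ tt)) (inj₂ (inj₁ i′)) _   = μC-reverse (path-to-z true i′)
  hamiltonConnected (inj₂ (inj₂ tt)) (inj₂ (inj₂ tt)) z≢z = ⊥-elim (z≢z refl)

theorem13 : ∀ (n : ℕ) → 3 ≤ n → (∃[ k ] n ≡ suc (2 * k)) → HamiltonConnected (Mycielskian (Cycle n))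
theorem13 (suc (suc (suc m))) (s≤s (s≤s (s≤s z≤n))) (k , n≡2k+1) = OddCycle.hamiltonConnected m n-odd
  where
  n-odd : odd? (3 + m) ≡ true
  n-odd = trans (cong odd? n≡2k+1) (odd?-1+2k k)
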